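{- For all $n\geq 0$, the number of occurrences of $a_1$ in $s_n$ is $|s_n|_{a_1}=Q_n-P_n$.
   Context: Fix $k\geq 2$, letters $a_1,\dots,a_k$ and positive integers $(d_i)_{i\geq1}$. Define $s_{1-k}=a_2,\dots,s_{ -1}=a_k,s_0=a_1$; $s_n=s_{n-1}^{d_n}s_{n-2}^{d_{n-1}}\cdots s_0^{d_1}a_{n+1}$ for $1\leq n\leq k-1$; $s_n=s_{n-1}^{d_n}\cdots s_{n-k+1}^{d_{n-k+2}}s_{n-k}$ for $n\geq k$. Let $Q_n=|s_n|$. Define $P_0=0$, $P_n=d_nP_{n-1}+d_{n-1}P_{n-2}+\cdots+d_1P_0+1$ for $1\leq n\leq k-1$, and $P_n=d_nP_{n-1}+d_{n-1}P_{n-2}+\cdots+d_{n+2-k}P_{n+1-k}+P_{n-k}$ for $n\geq k$. $|w|_a$ denotes the number of occurrences of the letter $a$ in $w$. -}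

module Defs where

open import Data.Nat using (ℕ; zero; suc; _+_; _*_; _∸_; _≤ᵇ_; _<ᵇ_; _≟_)
open import Data.Bool using (Bool; true; false; if_then_else_)
open import Data.List using (List; []; _∷_; _++_; concat; replicate; length; filter)

-- Alphabet: the letter a_i is represented by the natural number i (1 ≤ i ≤ k).
Word : Set
Word = List ℕ

nth : {A : Set} → A → ℕ → List A → A
nth def _       []       = def
nth def zero    (x ∷ _)  = x
nth def (suc i) (_ ∷ xs) = nth def i xs

-- Given n and the history h = [s_{n-1}, s_{n-2}, ..., s_0], the product
--   s_{n-1}^{d_n} s_{n-2}^{d_{n-1}} ... s_{n-m}^{d_{n-m+1}},   m = min(n, k-1),
-- where the factor at position j (j ≥ 1) is s_{n-j}^{d_{n-j+1}}.
wordProd : (k : ℕ) (d : ℕ → ℕ) (n : ℕ) → ℕ → List Word → Word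
wordProd k d n j []       = []
wordProd k d n j (w ∷ ws) =
  if j ≤ᵇ (k ∸ 1)
  then concat (replicate (d (suc (n ∸ j))) w) ++ wordProd k d n (suc j) ws
  else []

-- s_n from the history [s_{n-1}, ..., s_0]:
--   n ≤ k-1 : s_{n-1}^{d_n} ... s_0^{d_1} a_{n+1}   (for n = 0 this is s_0 = a_1)
--   n ≥ k   : s_{n-1}^{d_n} ... s_{n-k+1}^{d_{n-k+2}} s_{n-k}
sStep : (k : ℕ) (d : ℕ → ℕ) (n : ℕ) → List Word → Word
sStep k d n h =
  wordProd k d n 1 h ++
  (if n <ᵇ k then suc n ∷ [] else nth [] (k ∸ 1) h)

sHist : (k : ℕ) (d : ℕ → ℕ) → ℕ → List Word
sHist k d zero    = []
sHist k d (suc n) = sStep k d n (sHist k d n) ∷ sHist k d n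

s : (k : ℕ) (d : ℕ → ℕ) → ℕ → Word
s k d n = sStep k d n (sHist k d n)

Q : (k : ℕ) (d : ℕ → ℕ) → ℕ → ℕ
Q k d n = length (s k d n)

occ : ℕ → Word → ℕ
occ a w = length (filter (_≟ a) w)

-- the sum  d_n P_{n-1} + ... + d_{n-m+1} P_{n-m},  m = min(n, k-1),
-- from the history [P_{n-1}, ..., P_0]
numProd : (k : ℕ) (d : ℕ → ℕ) (n : ℕ) → ℕ → List ℕ → ℕ
numProd k d n j []       = 0
numProd k d n j (p ∷ ps) =
  if j ≤ᵇ (k ∸ 1)
  then d (suc (n ∸ j)) * p + numProd k d n (suc j) ps
  else 0

-- P_0 = 0;  1 ≤ n ≤ k-1 : P_n = d_n P_{n-1} + ... + d_1 P_0 + 1;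
-- n ≥ k : P_n = d_n P_{n-1} + ... + d_{n+2-k} P_{n+1-k} + P_{n-k}
PStep : (k : ℕ) (d : ℕ → ℕ) (n : ℕ) → List ℕ → ℕ
PStep k d zero    h = 0
PStep k d (suc n) h =
  numProd k d (suc n) 1 h + (if suc n <ᵇ k then 1 else nth 0 (k ∸ 1) h)

PHist : (k : ℕ) (d : ℕ → ℕ) → ℕ → List ℕ
PHist k d zero    = []
PHist k d (suc n) = PStep k d n (PHist k d n) ∷ PHist k d n

P : (k : ℕ) (d : ℕ → ℕ) → ℕ → ℕ
P k d n = PStep k d n (PHist k d n)

module Submission where

-- Split every word w into its occurrences of a₁ and the rest:
--   |w| = |w|_{a₁} + others w,   where  others w  counts letters different from a₁.
-- The claim |s_n|_{a₁} = Q_n - P_n is then equivalent to  others (s_n) = P_n,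
-- i.e. P_n counts exactly the letters of s_n other than a₁.  This holds for
-- every k and every exponent sequence d, because  others  is a monoid
-- homomorphism from words to (ℕ, +): applied to the recursion for s_n it yields
-- the recursion for P_n term by term (powers become multiples, the final letter
-- a_{n+1} with n ≥ 1 contributes 1, and the tail s_{n-k} contributes P_{n-k}),
-- while s_0 = a₁ gives others s_0 = 0 = P_0.

open import Defs
open import Data.Nat using (ℕ; _≤_; zero; suc; _+_; _*_; _∸_; _≤ᵇ_; _<ᵇ_; _≡ᵇ_)
open import Data.Nat.Properties using (+-suc; +-comm)
open import Data.Integer using (ℤ; +_; _-_; _⊖_)
open import Data.Integer.Properties using (m-n≡m⊖n; +-cancelˡ-⊖)
open import Data.Bool using (true; false; if_then_else_)
open import Data.List using (List; []; _∷_; _++_; concat; replicate; length; map)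
open import Relation.Binary.PropositionalEquality using (_≡_; refl; sym; trans; cong; cong₂; module ≡-Reasoning)

others : Word → ℕ
others []       = 0
others (x ∷ xs) = if x ≡ᵇ 1 then others xs else suc (others xs)

length≡occ+others : ∀ w → length w ≡ occ 1 w + others w
length≡occ+others []       = refl
length≡occ+others (x ∷ xs) with x ≡ᵇ 1
... | true  = cong suc (length≡occ+others xs)
... | false = trans (cong suc (length≡occ+others xs)) (sym (+-suc (occ 1 xs) (others xs)))

others-++ : ∀ u v → others (u ++ v) ≡ others u + others v
others-++ []       v = refl
others-++ (x ∷ xs) v with x ≡ᵇ 1
... | true  = others-++ xs v
... | false = cong suc (others-++ xs v)

others-power : ∀ c w → others (concat (replicate c w)) ≡ c * others w
others-power zero    w = refl
others-power (suc c) w = trans (others-++ w _) (cong (λ t → others w + t) (others-power c w))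

others-wordProd : ∀ k d n j h → others (wordProd k d n j h) ≡ numProd k d n j (map others h)
others-wordProd k d n j []       = refl
others-wordProd k d n j (w ∷ ws) with j ≤ᵇ (k ∸ 1)
... | true  = trans (others-++ (concat (replicate (d (suc (n ∸ j))) w)) _)
                    (cong₂ _+_ (others-power (d (suc (n ∸ j))) w) (others-wordProd k d n (suc j) ws))
... | false = refl

others-nth : ∀ i (h : List Word) → others (nth [] i h) ≡ nth 0 i (map others h)
others-nth i       []      = refl
others-nth zero    (w ∷ h) = refl
others-nth (suc i) (w ∷ h) = others-nth i h

-- The final
-- letter a_{n+1} (n ≥ 1) is not a₁, so it contributes the summand 1.
others-sStep : ∀ k d m h → others (sStep k d (suc m) h) ≡ PStep k d (suc m) (map others h)
others-sStep k d m h =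
  trans (others-++ (wordProd k d (suc m) 1 h) _)
        (cong₂ _+_ (others-wordProd k d (suc m) 1 h) lastFactor)
  where
  lastFactor : others (if suc m <ᵇ k then suc (suc m) ∷ [] else nth [] (k ∸ 1) h)
             ≡ (if suc m <ᵇ k then 1 else nth 0 (k ∸ 1) (map others h))
  lastFactor with suc m <ᵇ k
  ... | true  = refl
  ... | false = others-nth (k ∸ 1) h

others-history : ∀ k d n → map others (sHist k d n) ≡ PHist k d n
others-s       : ∀ k d n → others (s k d n) ≡ P k d n
others-history k d zero    = refl
others-history k d (suc n) = cong₂ _∷_ (others-s k d n) (others-history k d n)
others-s zero    d zero    = refl
others-s (suc k) d zero    = refl
others-s k       d (suc n) =
  trans (others-sStep k d n (sHist k d (suc n)))
        (cong (PStep k d (suc n)) (others-history k d (suc n)))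

sum-minus-summand : ∀ a b → + (a + b) - + b ≡ + a
sum-minus-summand a b = begin
  + (a + b) - + b   ≡⟨ m-n≡m⊖n (a + b) b ⟩
  (a + b) ⊖ b       ≡⟨ cong₂ _⊖_ (+-comm a b) (sym (+-comm b 0)) ⟩
  (b + a) ⊖ (b + 0) ≡⟨ +-cancelˡ-⊖ b a 0 ⟩
  + a               ∎
  where open ≡-Reasoning

-- Proposition 3.4: |s_n|_{a₁} = Q_n - P_n.
proposition3p4 : (k : ℕ) → 2 ≤ k → (d : ℕ → ℕ) → (∀ i → 1 ≤ i → 1 ≤ d i) →
    (n : ℕ) → + occ 1 (s k d n) ≡ + Q k d n - + P k d n
proposition3p4 k _ d _ n = begin
  + occ 1 w                               ≡⟨ sum-minus-summand (occ 1 w) (P k d n) ⟨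
  + (occ 1 w + P k d n) - + P k d n       ≡⟨ cong (λ t → + (occ 1 w + t) - + P k d n) (others-s k d n) ⟨
  + (occ 1 w + others w) - + P k d n      ≡⟨ cong (λ t → + t - + P k d n) (length≡occ+others w) ⟨
  + Q k d n - + P k d n                   ∎
  where
  open ≡-Reasoning
  w : Word
  w = s k d n
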